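{- Let $T$ be an $spo(2m,n)$-tableau and let $x,x'\in B_0\cup B_1$ such that $x\leq x'$ if $x,x'\in B_0$, and $x<x'$ otherwise. Suppose that $T\leftarrow x$ has one more box $B$ than $T$ and that $(T\leftarrow x)\leftarrow x'$ has one more box $B'$ than $T\leftarrow x$. Then $B'$ lies strictly to the right of $B$.
   Context: Fix positive integers $m,n$. Let $B_0=\{1,\overline{1},2,\overline{2},\dots,m,\overline{m}\}$ and $B_1=\{1^\circ,\dots,n^\circ\}$, totally ordered by $1<\overline{1}<2<\overline{2}<\cdots<m<\overline{m}<1^\circ<2^\circ<\cdots<n^\circ$. Young diagrams are drawn with row $1$ on top. An $spo(2m,n)$-tableau of shape $\lambda$ is a filling of the Young diagram of $\lambda$ with entries of $B_0\cup B_1$ such that: the boxes containing entries of $B_0$ form a Young diagram of some shape $\mu\subseteq\lambda$, on which the entries are weakly increasing along rows, strictly increasing down columns, and every entry in row $i$ is $\geq i$ (no $j$ or $\overline{j}$ with $j<i$ in row $i$); and the entries of $B_1$, filling $\lambda/\mu$, are strictly increasing along rows and weakly increasing down columns. Forward slide: given a filling with one empty box, let $x$ be the entry immediately right of it and $y$ the entry immediately below it; if only one exists it moves into the empty box; if both exist, $x$ moves left if $x<y$ or $x=y\in B_1$, and $y$ moves up if $y<x$ or $x=y\in B_0$. Slides are repeated until the empty box is at an outer corner, which is then deleted. $spo$-insertion $T\leftarrow x$: insert $z=x$ into row $1$. To insert $z$ into row $r$: if $z\in B_0$ and $z$ is $\geq$ all entries of row $r$, or $z\in B_1$ and $z$ is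 $>$ all entries of row $r$ (including the case of an empty row below the tableau), append $z$ in a new box at the end of row $r$ and stop. Otherwise, if $z\in B_1$ let $z'$ be the leftmost entry of row $r$ with $z'\geq z$; if $z\in B_0$ let $z'$ be the leftmost entry with $z'>z$; replace $z'$ by $z$ and insert $z'$ into row $r+1$. If at some stage an entry $i\in\{1,\dots,m\}$ inserted into row $i$ would bump an $\overline{i}$ from row $i$ (a cancellation), then at the first such stage the $\overline{i}$ is removed instead (and $i$ is not placed), and forward slides are applied to the resulting empty box until it reaches an outer corner, where the box is deleted; then $T\leftarrow x$ has one box fewer than $T$, otherwise one box more. -}

module Defs where

open import Data.Nat using (ℕ; zero; suc; _+_; _*_; _≤_; _<_; _<ᵇ_; _≤ᵇ_; _≡ᵇ_)
open import Data.Fin using (Fin; toℕ)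
open import Data.Bool using (Bool; true; false; _∧_; _∨_; not; if_then_else_)
open import Data.List using (List; []; _∷_; _++_; length; map)
open import Data.Nat.ListAction using (sum)
open import Data.Maybe using (Maybe; just; nothing)
open import Data.Product using (_×_; _,_; ∃)
open import Relation.Binary.PropositionalEquality using (_≡_; _≢_)
open import Relation.Nullary using (¬_)

-- The alphabet B₀ ∪ B₁.
-- Indices are 0-based: num i is the letter (toℕ i + 1), bar i is its bar,
-- circ j is the letter (toℕ j + 1)°.

data Letter (m n : ℕ) : Set where
  num  : Fin m → Letter m n
  bar  : Fin m → Letter m n
  circ : Fin n → Letter m n

module _ {m n : ℕ} where

  -- position in the total order 1 < 1̄ < 2 < 2̄ < ... < m < m̄ < 1° < ... < n°
  rank : Letter m n → ℕ
  rank (num i)  = 2 * toℕ i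
  rank (bar i)  = suc (2 * toℕ i)
  rank (circ j) = 2 * m + toℕ j

  _<L_ : Letter m n → Letter m n → Set
  x <L y = rank x < rank y

  _≤L_ : Letter m n → Letter m n → Set
  x ≤L y = rank x ≤ rank y

  isB0 : Letter m n → Bool
  isB0 (num _)  = true
  isB0 (bar _)  = true
  isB0 (circ _) = false

  IndexAtLeast : ℕ → Letter m n → Set
  IndexAtLeast r (num i)  = r ≤ toℕ i
  IndexAtLeast r (bar i)  = r ≤ toℕ i
  IndexAtLeast r (circ _) = r ≤ r

-- Fillings: lists of rows, row 0 on top (0-based row/column indices).

Tableau : ℕ → ℕ → Set
Tableau m n = List (List (Letter m n))

nth : {A : Set} → List A → ℕ → Maybe A
nth []       _       = nothing
nth (a ∷ as) zero    = just a
nth (a ∷ as) (suc k) = nth as k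

setAt : {A : Set} → List A → ℕ → A → List A
setAt []       _       _ = []
setAt (a ∷ as) zero    b = b ∷ as
setAt (a ∷ as) (suc k) b = a ∷ setAt as k b

entry : {A : Set} → List (List A) → ℕ → ℕ → Maybe A
entry T r c with nth T r
... | nothing  = nothing
... | just row = nth row c

size : {A : Set} → List (List A) → ℕ
size T = sum (map length T)

IsBox : {A : Set} → List (List A) → ℕ → ℕ → Set
IsBox T r c = ∃ λ e → entry T r c ≡ just e

module _ {m n : ℕ} where

  IsB0At : Tableau m n → ℕ → ℕ → Set
  IsB0At T r c = ∃ λ e → entry T r c ≡ just e × isB0 e ≡ true

  NoEmptyRows : Tableau m n → Set
  NoEmptyRows [] = ⊤'
    where open import Data.Unit using () renaming (⊤ to ⊤')
  NoEmptyRows (row ∷ rows) = (row ≢ []) × NoEmptyRows rows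

  record IsSpoTableau (T : Tableau m n) : Set where
    field
      noEmptyRows : NoEmptyRows T
      shape  : ∀ r c r' c' → r' ≤ r → c' ≤ c → IsBox T r c → IsBox T r' c'
      shape0 : ∀ r c r' c' → r' ≤ r → c' ≤ c → IsB0At T r c → IsB0At T r' c'
      row0   : ∀ r c x y → entry T r c ≡ just x → entry T r (suc c) ≡ just y →
               isB0 x ≡ true → isB0 y ≡ true → x ≤L y
      col0   : ∀ r c x y → entry T r c ≡ just x → entry T (suc r) c ≡ just y →
               isB0 x ≡ true → isB0 y ≡ true → x <L y
      -- every B₀ entry in (1-based) row r+1 is ≥ r+1
      rowBound : ∀ r c x → entry T r c ≡ just x → IndexAtLeast r x
      row1   : ∀ r c x y → entry T r c ≡ just x → entry T r (suc c) ≡ just y →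
               isB0 x ≡ false → isB0 y ≡ false → x <L y
      col1   : ∀ r c x y → entry T r c ≡ just x → entry T (suc r) c ≡ just y →
               isB0 x ≡ false → isB0 y ≡ false → x ≤L y

  Filling : Set
  Filling = List (List (Maybe (Letter m n)))

  bumps : Letter m n → Letter m n → Bool
  bumps z e = if isB0 z then rank z <ᵇ rank e else rank z ≤ᵇ rank e

  splitBump : Letter m n → List (Letter m n) →
              Maybe (List (Letter m n) × Letter m n × List (Letter m n))
  splitBump z [] = nothing
  splitBump z (e ∷ es) with bumps z e
  ... | true  = just ([] , e , es)
  ... | false with splitBump z es
  ...   | nothing = nothing
  ...   | just (p , b , s) = just (e ∷ p , b , s)

  -- z = i inserted into row i bumps ī  (0-based: num i into row toℕ i)
  isCancel : ℕ → Letter m n → Letter m n → Bool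
  isCancel r (num i) (bar j) = (toℕ i ≡ᵇ r) ∧ (toℕ i ≡ᵇ toℕ j)
  isCancel r _ _ = false

  data InsResult : Set where
    added     : Tableau m n → InsResult
    -- filling with a single empty box (nothing) at the given row/column
    cancelled : Filling → ℕ → ℕ → InsResult

  prependRow : List (Letter m n) → InsResult → InsResult
  prependRow row (added T)         = added (row ∷ T)
  prependRow row (cancelled F r c) = cancelled (map just row ∷ F) r c

  -- insert z into row r (the list starts at row r)
  insRow : ℕ → Letter m n → Tableau m n → InsResult
  insRow r z [] = added ((z ∷ []) ∷ [])
  insRow r z (row ∷ rows) with splitBump z row
  ... | nothing = added ((row ++ z ∷ []) ∷ rows)
  ... | just (p , e , s) with isCancel r z e
  ...   | true  = cancelled ((map just p ++ nothing ∷ map just s) ∷ map (map just) rows)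
                            r (length p)
  ...   | false = prependRow (p ++ z ∷ s) (insRow (suc r) e rows)

  neighbour : Filling → ℕ → ℕ → Maybe (Letter m n)
  neighbour F r c with entry F r c
  ... | just (just x) = just x
  ... | _             = nothing

  catMaybes : List (Maybe (Letter m n)) → List (Letter m n)
  catMaybes [] = []
  catMaybes (nothing ∷ xs) = catMaybes xs
  catMaybes (just x ∷ xs)  = x ∷ catMaybes xs

  dropEmpty : Tableau m n → Tableau m n
  dropEmpty [] = []
  dropEmpty ([] ∷ rows) = dropEmpty rows
  dropEmpty ((x ∷ xs) ∷ rows) = (x ∷ xs) ∷ dropEmpty rows

  deleteHole : Filling → Tableau m n
  deleteHole F = dropEmpty (map catMaybes F)

  set2 : Filling → ℕ → ℕ → Maybe (Letter m n) → Filling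
  set2 F r c v with nth F r
  ... | nothing  = F
  ... | just row = setAt F r (setAt row c v)

  -- forward slides with fuel (each slide moves the hole into a new box,
  -- so fuel = number of boxes suffices)
  slides : ℕ → Filling → ℕ → ℕ → Tableau m n
  slides zero F r c = deleteHole F
  slides (suc f) F r c with neighbour F r (suc c) | neighbour F (suc r) c
  ... | nothing | nothing = deleteHole F
  ... | just x  | nothing = slides f (set2 (set2 F r c (just x)) r (suc c) nothing) r (suc c)
  ... | nothing | just y  = slides f (set2 (set2 F r c (just y)) (suc r) c nothing) (suc r) c
  ... | just x  | just y with (rank x <ᵇ rank y) ∨ ((rank x ≡ᵇ rank y) ∧ not (isB0 x))
  ...   | true  = slides f (set2 (set2 F r c (just x)) r (suc c) nothing) r (suc c)
  ...   | false = slides f (set2 (set2 F r c (just y)) (suc r) c nothing) (suc r) c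

  insert : Tableau m n → Letter m n → Tableau m n
  insert T x with insRow 0 x T
  ... | added T'          = T'
  ... | cancelled F r c   = slides (size T) F r c

  OrderHyp : Letter m n → Letter m n → Set
  OrderHyp x x' = if isB0 x ∧ isB0 x' then x ≤L x' else x <L x'

  NewBox : Tableau m n → Tableau m n → ℕ → ℕ → Set
  NewBox T T' r c = IsBox T' r c × ¬ IsBox T r c

module Submission where

-- A cancelling insertion deletes an entry and then only slides entries around, so it never
-- produces more boxes than it started with; both insertions are therefore plain row insertions.  Write a ≼ z when z,
-- inserted into a row, passes a: rows of an spo-tableau are ≼-chains and every entry is
-- bumped by the one above it.  After z has been inserted, z′ ≽ z passes every entry up to and
-- including z, so in each row z′ bumps strictly to the right of z, and what it bumps is ≽ what
-- z bumped; the argument recurses down the rows.  If z′ comes to rest first, the box added by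
-- z lies weakly left of the column in which z bumped, since bumped entries only move weakly
-- left as they descend.

open import Defs
open import Data.Nat using (ℕ; zero; suc; _+_; _*_; _≤_; _<_; _<ᵇ_; _≤ᵇ_; _≡ᵇ_; z≤n; s≤s)
open import Data.Nat.Properties
open import Data.Fin using (toℕ)
open import Data.Fin.Properties using (toℕ<n)
open import Data.Bool using (true; false; T; _∧_; _∨_; not)
open import Data.Unit using (tt)
open import Data.List using (List; []; _∷_; _++_; _∷ʳ_; length; map)
open import Data.List.Properties using (++-assoc; ++-identityʳ; ∷-injectiveʳ; length-map)
open import Data.List.Relation.Unary.All as All using (All; []; _∷_)
open import Data.List.Relation.Unary.All.Properties using (++⁻ʳ; ∷ʳ⁺)
open import Data.List.Relation.Unary.AllPairs using (AllPairs; []; _∷_)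
open import Data.List.Relation.Unary.Linked using (Linked; []; [-]; _∷_)
open import Data.List.Relation.Unary.Linked.Properties using (Linked⇒AllPairs)
open import Data.List.Relation.Binary.Prefix.Heterogeneous using (Prefix; []; _∷_)
open import Data.Maybe using (Maybe; just; nothing)
open import Data.Product using (_×_; _,_; ∃-syntax)
open import Data.Sum using (_⊎_; inj₁; inj₂)
open import Function using (flip)
open import Relation.Binary.Definitions using (Transitive)
open import Relation.Binary.PropositionalEquality
open import Relation.Nullary using (¬_; contradiction)

module _ {A : Set} where

  length-<-++-∷ : ∀ (p : List A) {x s} → length p < length (p ++ x ∷ s)
  length-<-++-∷ []      = s≤s z≤n
  length-<-++-∷ (_ ∷ p) = s≤s (length-<-++-∷ p)

  length-++-∷-swap : ∀ (p : List A) {x y s} → length (p ++ x ∷ s) ≡ length (p ++ y ∷ s)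
  length-++-∷-swap []      = refl
  length-++-∷-swap (_ ∷ p) = cong suc (length-++-∷-swap p)

  length-map-++-∷ : ∀ {B : Set} (f : A → B) (p : List A) {x y s} →
                    length (map f p ++ y ∷ map f s) ≡ length (p ++ x ∷ s)
  length-map-++-∷ f []      {s = s} = cong suc (length-map f s)
  length-map-++-∷ f (_ ∷ p)         = cong suc (length-map-++-∷ f p)

  nth-just⇒< : ∀ (xs : List A) {c a} → nth xs c ≡ just a → c < length xs
  nth-just⇒< (_ ∷ _)  {zero}  _ = s≤s z≤n
  nth-just⇒< (_ ∷ xs) {suc c} h = s≤s (nth-just⇒< xs h)

  <⇒nth-just : ∀ (xs : List A) {c} → c < length xs → ∃[ a ] nth xs c ≡ just a
  <⇒nth-just (x ∷ _)  {zero}  _         = x , refl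
  <⇒nth-just (_ ∷ xs) {suc c} (s≤s c<n) = <⇒nth-just xs c<n

  nth-∷ʳ-new : ∀ (xs : List A) {z c} → ∃[ a ] nth (xs ∷ʳ z) c ≡ just a →
               ¬ (∃[ a ] nth xs c ≡ just a) → c ≡ length xs
  nth-∷ʳ-new []       {c = zero}  _        _    = refl
  nth-∷ʳ-new []       {c = suc c} (_ , ()) _
  nth-∷ʳ-new (x ∷ _)  {c = zero}  _        ¬old = contradiction (x , refl) ¬old
  nth-∷ʳ-new (_ ∷ xs) {c = suc c} new      ¬old = cong suc (nth-∷ʳ-new xs new ¬old)

  suffix-from-first-failure : ∀ {P : A → Set} {e t s} (q p : List A) → All P q → ¬ P e →
                              q ++ t ≡ p ++ e ∷ s → ∃[ u ] t ≡ u ++ e ∷ s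
  suffix-from-first-failure []      p       _          _   eq   = p , eq
  suffix-from-first-failure (_ ∷ _) []      (Pe ∷ _)   ¬Pe refl = contradiction Pe ¬Pe
  suffix-from-first-failure (_ ∷ q) (_ ∷ p) (_ ∷ allq) ¬Pe eq   =
    suffix-from-first-failure q p allq ¬Pe (∷-injectiveʳ eq)

  AllPairs-before : ∀ {R : A → A → Set} (p u : List A) {x y s} →
                    AllPairs R (p ++ x ∷ u ++ y ∷ s) → R x y
  AllPairs-before []      u (Rx ∷ _) = All.head (++⁻ʳ u Rx)
  AllPairs-before (_ ∷ p) u (_ ∷ Rs) = AllPairs-before p u Rs

  Prefix-length-≤ : ∀ {C : A → A → Set} {e t s} (q p : List A) → All (λ b → ¬ C e b) q →
                    Prefix (flip C) (q ++ t) (p ++ e ∷ s) → length q ≤ length p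
  Prefix-length-≤ []      _       _           _          = z≤n
  Prefix-length-≤ (_ ∷ _) []      (¬Ceb ∷ _)  (Ceb ∷ _)  = contradiction Ceb ¬Ceb
  Prefix-length-≤ (_ ∷ q) (_ ∷ p) (_ ∷ allq)  (_ ∷ pre)  = s≤s (Prefix-length-≤ q p allq pre)

  length-setAt : ∀ (xs : List A) k v → length (setAt xs k v) ≡ length xs
  length-setAt []       _       _ = refl
  length-setAt (_ ∷ xs) zero    _ = refl
  length-setAt (_ ∷ xs) (suc k) v = cong suc (length-setAt xs k v)

  size-setAt : ∀ (F : List (List A)) r {R R′} → nth F r ≡ just R → length R′ ≡ length R →
               size (setAt F r R′) ≡ size F
  size-setAt (_ ∷ F) zero    refl len = cong (_+ size F) len
  size-setAt (X ∷ F) (suc r) h    len = cong (length X +_) (size-setAt F r h len)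

  size-map-map : ∀ {B : Set} (f : A → B) (T : List (List A)) → size (map (map f) T) ≡ size T
  size-map-map f []      = refl
  size-map-map f (R ∷ T) = cong₂ _+_ (length-map f R) (size-map-map f T)

topRow : {A : Set} → List (List A) → List A
topRow []      = []
topRow (R ∷ _) = R

-- Rows are R-chains; each row is no longer than the one above it, and C holds down every column.
data Ordered {A : Set} (R C : A → A → Set) : List (List A) → Set where
  []  : Ordered R C []
  row : ∀ {xs rows} → AllPairs R xs → Prefix (flip C) (topRow rows) xs → Ordered R C rows →
        Ordered R C (xs ∷ rows)

entry-suc : ∀ {A : Set} (R : List A) rows r c → entry (R ∷ rows) (suc r) c ≡ entry rows r c
entry-suc R rows r c with nth rows r
... | nothing = refl
... | just _  = refl

entry-topRow : ∀ {A : Set} (R : List A) rows c → entry (R ∷ rows) 1 c ≡ nth (topRow rows) c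
entry-topRow R []      c = refl
entry-topRow R (_ ∷ _) c = refl

module _ {A : Set} {R C : A → A → Set} where

  linked-from-nth : ∀ (xs : List A) →
                    (∀ c {x y} → nth xs c ≡ just x → nth xs (suc c) ≡ just y → R x y) → Linked R xs
  linked-from-nth []           _    = []
  linked-from-nth (_ ∷ [])     _    = [-]
  linked-from-nth (_ ∷ y ∷ xs) step = step 0 refl refl ∷ linked-from-nth (y ∷ xs) (λ c → step (suc c))

  prefix-from-nth : ∀ (ys xs : List A) →
                    (∀ c {y} → nth ys c ≡ just y → ∃[ x ] nth xs c ≡ just x × C x y) →
                    Prefix (flip C) ys xs
  prefix-from-nth []       _  _     = []
  prefix-from-nth (y ∷ ys) xs above with above 0 refl
  prefix-from-nth (y ∷ ys) []       above | _ , () , _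
  prefix-from-nth (y ∷ ys) (_ ∷ xs) above | _ , refl , Cxy =
    Cxy ∷ prefix-from-nth ys xs (λ c → above (suc c))

  ordered-from-entries : Transitive R → ∀ (T : List (List A)) →
    (∀ r c {x y} → entry T r c ≡ just x → entry T r (suc c) ≡ just y → R x y) →
    (∀ r c {y} → entry T (suc r) c ≡ just y → ∃[ x ] entry T r c ≡ just x × C x y) →
    Ordered R C T
  ordered-from-entries _       []          _       _       = []
  ordered-from-entries R-trans (xs ∷ rows) rowStep colStep =
    row (Linked⇒AllPairs R-trans (linked-from-nth xs (rowStep 0)))
        (prefix-from-nth (topRow rows) xs (λ c hy → colStep 0 c (trans (entry-topRow xs rows c) hy)))
        (ordered-from-entries R-trans rows rowStep′ colStep′)
    where
    rowStep′ : ∀ r c {x y} → entry rows r c ≡ just x → entry rows r (suc c) ≡ just y → R x y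
    rowStep′ r c hx hy =
      rowStep (suc r) c (trans (entry-suc xs rows r c) hx) (trans (entry-suc xs rows r (suc c)) hy)
    colStep′ : ∀ r c {y} → entry rows (suc r) c ≡ just y → ∃[ x ] entry rows r c ≡ just x × C x y
    colStep′ r c hy with colStep (suc r) c (trans (entry-suc xs rows (suc r) c) hy)
    ... | x , hx , Cxy = x , trans (sym (entry-suc xs rows r c)) hx , Cxy

<ᵇ-false⇒≥ : ∀ {a b} → (a <ᵇ b) ≡ false → b ≤ a
<ᵇ-false⇒≥ h = ≮⇒≥ (λ lt → subst T h (<⇒<ᵇ lt))

<ᵇ-true⇒< : ∀ {a b} → (a <ᵇ b) ≡ true → a < b
<ᵇ-true⇒< {a} {b} h = <ᵇ⇒< a b (subst T (sym h) tt)

≤ᵇ-false⇒> : ∀ {a b} → (a ≤ᵇ b) ≡ false → b < a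
≤ᵇ-false⇒> h = ≰⇒> (λ le → subst T h (≤⇒≤ᵇ le))

≤ᵇ-true⇒≤ : ∀ {a b} → (a ≤ᵇ b) ≡ true → a ≤ b
≤ᵇ-true⇒≤ {a} {b} h = ≤ᵇ⇒≤ a b (subst T (sym h) tt)

module _ {m n : ℕ} where

  B0-or-B1 : (x : Letter m n) → isB0 x ≡ true ⊎ isB0 x ≡ false
  B0-or-B1 (num _)  = inj₁ refl
  B0-or-B1 (bar _)  = inj₁ refl
  B0-or-B1 (circ _) = inj₂ refl

  B0<B1 : ∀ {x y : Letter m n} → isB0 x ≡ true → isB0 y ≡ false → rank x < rank y
  B0<B1 {num i} {circ j} _ _ = <-≤-trans (*-monoʳ-< 2 (toℕ<n i)) (m≤m+n (2 * m) (toℕ j))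
  B0<B1 {bar i} {circ j} _ _ = ≤-trans (≤-reflexive (sym (*-suc 2 (toℕ i))))
                                       (≤-trans (*-monoʳ-≤ 2 (toℕ<n i)) (m≤m+n (2 * m) (toℕ j)))

  infix 4 _≼_ _⊲_

  -- OrderHyp wrapped in a record, so that the letters can be inferred from a proof.
  record _≼_ (x y : Letter m n) : Set where
    constructor mk≼
    field get : OrderHyp x y

  -- x ⊲ y says that x, inserted into a row, would bump y.
  _⊲_ : Letter m n → Letter m n → Set
  x ⊲ y = ¬ (y ≼ x)

  ≼⇒≤ : ∀ {x y} → x ≼ y → rank x ≤ rank y
  ≼⇒≤ {x} {y} (mk≼ h) with isB0 x ∧ isB0 y
  ... | true  = h
  ... | false = <⇒≤ h

  ≼⇒<ˡ : ∀ {x y} → isB0 x ≡ false → x ≼ y → rank x < rank y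
  ≼⇒<ˡ {circ _} _ (mk≼ h) = h

  ≼⇒<ʳ : ∀ {x y} → isB0 y ≡ false → x ≼ y → rank x < rank y
  ≼⇒<ʳ {num _}  {circ _} _ (mk≼ h) = h
  ≼⇒<ʳ {bar _}  {circ _} _ (mk≼ h) = h
  ≼⇒<ʳ {circ _} {circ _} _ (mk≼ h) = h

  <⇒≼ : ∀ {x y} → rank x < rank y → x ≼ y
  <⇒≼ {x} {y} x<y = mk≼ orderHyp
    where
    orderHyp : OrderHyp x y
    orderHyp with isB0 x ∧ isB0 y
    ... | true  = <⇒≤ x<y
    ... | false = x<y

  ≤⇒≼ : ∀ {x y} → isB0 x ≡ true → isB0 y ≡ true → rank x ≤ rank y → x ≼ y
  ≤⇒≼ {num _} {num _} _ _ h = mk≼ h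
  ≤⇒≼ {num _} {bar _} _ _ h = mk≼ h
  ≤⇒≼ {bar _} {num _} _ _ h = mk≼ h
  ≤⇒≼ {bar _} {bar _} _ _ h = mk≼ h

  ≼⇒¬⊲ : ∀ {x y} → x ≼ y → ¬ (y ⊲ x)
  ≼⇒¬⊲ x≼y y⊲x = y⊲x x≼y

  ≼-trans : Transitive _≼_
  ≼-trans {x} {_} {z} x≼y y≼z with B0-or-B1 x | B0-or-B1 z
  ... | inj₁ bx | inj₁ bz = ≤⇒≼ bx bz (≤-trans (≼⇒≤ x≼y) (≼⇒≤ y≼z))
  ... | inj₂ bx | _       = <⇒≼ (<-≤-trans (≼⇒<ˡ bx x≼y) (≼⇒≤ y≼z))
  ... | inj₁ _  | inj₂ bz = <⇒≼ (≤-<-trans (≼⇒≤ x≼y) (≼⇒<ʳ bz y≼z))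

  ≤-B0⇒≼ : ∀ a z → isB0 z ≡ true → rank a ≤ rank z → a ≼ z
  ≤-B0⇒≼ a z bz a≤z with B0-or-B1 a
  ... | inj₁ ba = ≤⇒≼ ba bz a≤z
  ... | inj₂ ba = contradiction a≤z (<⇒≱ (B0<B1 bz ba))

  bumps-false⇒≼ : ∀ z a → bumps z a ≡ false → a ≼ z
  bumps-false⇒≼ z@(num _) a h = ≤-B0⇒≼ a z refl (<ᵇ-false⇒≥ h)
  bumps-false⇒≼ z@(bar _) a h = ≤-B0⇒≼ a z refl (<ᵇ-false⇒≥ h)
  bumps-false⇒≼ z@(circ _) a h = <⇒≼ (≤ᵇ-false⇒> h)

  bumps-true⇒⊲ : ∀ z a → bumps z a ≡ true → z ⊲ a
  bumps-true⇒⊲ z@(num _)  a h a≼z = <⇒≱ (<ᵇ-true⇒< h) (≼⇒≤ a≼z)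
  bumps-true⇒⊲ z@(bar _)  a h a≼z = <⇒≱ (<ᵇ-true⇒< h) (≼⇒≤ a≼z)
  bumps-true⇒⊲ z@(circ _) a h a≼z = <⇒≱ (≼⇒<ʳ refl a≼z) (≤ᵇ-true⇒≤ h)

  splitBump-nothing : ∀ z R → splitBump z R ≡ nothing → All (_≼ z) R
  splitBump-nothing z []      _ = []
  splitBump-nothing z (a ∷ R) h with bumps z a in b
  splitBump-nothing z (a ∷ R) () | true
  ... | false with splitBump z R in rest
  ...   | nothing = bumps-false⇒≼ z a b ∷ splitBump-nothing z R rest
  splitBump-nothing z (a ∷ R) () | false | just _

  splitBump-just : ∀ z R {p e s} → splitBump z R ≡ just (p , e , s) →
                   R ≡ p ++ e ∷ s × All (_≼ z) p × z ⊲ e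
  splitBump-just z (a ∷ R) h with bumps z a in b
  splitBump-just z (a ∷ R) refl | true = refl , [] , bumps-true⇒⊲ z a b
  ... | false with splitBump z R in rest
  splitBump-just z (a ∷ R) () | false | nothing
  splitBump-just z (a ∷ R) refl | false | just _ with splitBump-just z R rest
  ... | refl , passed , z⊲e = refl , bumps-false⇒≼ z a b ∷ passed , z⊲e

  -- The bumped row is described by an equation rather than an index, so that the view
  -- can be taken of a row that is not a variable.
  data RowInsertion (k : ℕ) (z : Letter m n) : Tableau m n → Tableau m n → Set where
    created  : RowInsertion k z [] ((z ∷ []) ∷ [])
    appended : ∀ {R rows} → All (_≼ z) R → RowInsertion k z (R ∷ rows) ((R ∷ʳ z) ∷ rows)
    bumped   : ∀ {R rows p e s T} → R ≡ p ++ e ∷ s → All (_≼ z) p → z ⊲ e →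
               insRow (suc k) e rows ≡ added T → RowInsertion k z (R ∷ rows) ((p ++ z ∷ s) ∷ T)

  rowInsertion : ∀ {k z} T {T′} → insRow k z T ≡ added T′ → RowInsertion k z T T′
  rowInsertion []         refl = created
  rowInsertion {k} {z} (R ∷ rows) h with splitBump z R in split
  ... | nothing with h
  ...   | refl = appended (splitBump-nothing z R split)
  rowInsertion {k} {z} (R ∷ rows) h | just (p , e , s) with isCancel k z e
  rowInsertion (R ∷ rows) () | just (p , e , s) | true
  ... | false with insRow (suc k) e rows in below
  rowInsertion (R ∷ rows) () | just (p , e , s) | false | cancelled _ _ _
  ... | added _ with h | splitBump-just z R split
  ...   | refl | R≡ , passed , z⊲e = bumped R≡ passed z⊲e below

  -- Some row of T′ has a new box in column c; a data type rather than ∃, so that T, T′ and c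
  -- are inferable.
  data NewColumn (T T′ : Tableau m n) (c : ℕ) : Set where
    newColumn : ∀ r → NewBox T T′ r c → NewColumn T T′ c

  NewColumn-below : ∀ {R R′ rows rows′ c} → length R ≡ length R′ →
                    NewColumn (R ∷ rows) (R′ ∷ rows′) c → NewColumn rows rows′ c
  NewColumn-below {R} {R′} {c = c} len (newColumn zero ((_ , new) , ¬old)) =
    contradiction (<⇒nth-just R (subst (c <_) (sym len) (nth-just⇒< R′ new))) ¬old
  NewColumn-below {R} {R′} {rows} {rows′} {c} _ (newColumn (suc r) ((a , new) , ¬old)) =
    newColumn r ((a , trans (sym (entry-suc R′ rows′ r c)) new) ,
                 λ (b , old) → ¬old (b , trans (entry-suc R rows r c) old))

  NewColumn-∷ʳ : ∀ {R z rows c} → NewColumn (R ∷ rows) ((R ∷ʳ z) ∷ rows) c → c ≡ length R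
  NewColumn-∷ʳ {R} (newColumn zero (new , ¬old)) = nth-∷ʳ-new R new ¬old
  NewColumn-∷ʳ {R} {z} {rows} {c} (newColumn (suc r) ((a , new) , ¬old)) =
    contradiction (a , trans (entry-suc R rows r c) (trans (sym (entry-suc (R ∷ʳ z) rows r c)) new)) ¬old

  NewColumn-singleton : ∀ {z c} → NewColumn [] ((z ∷ []) ∷ []) c → c ≡ 0
  NewColumn-singleton {c = zero}  _                                  = refl
  NewColumn-singleton {c = suc c} (newColumn zero    ((_ , ()) , _))
  NewColumn-singleton {c = suc c} (newColumn (suc r) ((_ , ()) , _))

  size-set2 : ∀ (F : Filling {m} {n}) r c v → size (set2 F r c v) ≡ size F
  size-set2 F r c v with nth F r in row
  ... | nothing = refl
  ... | just R  = size-setAt F r row (length-setAt R c v)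

  size-dropEmpty : ∀ (T : Tableau m n) → size (dropEmpty T) ≡ size T
  size-dropEmpty []               = refl
  size-dropEmpty ([] ∷ T)         = size-dropEmpty T
  size-dropEmpty ((_ ∷ R) ∷ T)    = cong (suc (length R) +_) (size-dropEmpty T)

  length-catMaybes : ∀ (R : List (Maybe (Letter m n))) → length (catMaybes R) ≤ length R
  length-catMaybes []            = z≤n
  length-catMaybes (nothing ∷ R) = m≤n⇒m≤1+n (length-catMaybes R)
  length-catMaybes (just _ ∷ R)  = s≤s (length-catMaybes R)

  size-deleteHole : ∀ (F : Filling {m} {n}) → size (deleteHole F) ≤ size F
  size-deleteHole F = ≤-trans (≤-reflexive (size-dropEmpty (map catMaybes F))) (go F)
    where
    go : ∀ F → size (map catMaybes F) ≤ size F
    go []      = z≤n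
    go (R ∷ F) = +-mono-≤ (length-catMaybes R) (go F)

  size-slides : ∀ f (F : Filling {m} {n}) r c → size (slides f F r c) ≤ size F
  size-slide  : ∀ f (F : Filling {m} {n}) r c r′ c′ v →
                size (slides f (set2 (set2 F r c v) r′ c′ nothing) r′ c′) ≤ size F

  size-slides zero    F r c = size-deleteHole F
  size-slides (suc f) F r c with neighbour F r (suc c) | neighbour F (suc r) c
  ... | nothing | nothing = size-deleteHole F
  ... | just x  | nothing = size-slide f F r c r (suc c) (just x)
  ... | nothing | just y  = size-slide f F r c (suc r) c (just y)
  ... | just x  | just y with (rank x <ᵇ rank y) ∨ ((rank x ≡ᵇ rank y) ∧ not (isB0 x))
  ...   | true  = size-slide f F r c r (suc c) (just x)
  ...   | false = size-slide f F r c (suc r) c (just y)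

  size-slide f F r c r′ c′ v = ≤-trans (size-slides f _ r′ c′)
    (≤-reflexive (trans (size-set2 (set2 F r c v) r′ c′ nothing) (size-set2 F r c v)))

  insRow-cancelled-size : ∀ {k z} (T : Tableau m n) {F r c} → insRow k z T ≡ cancelled F r c →
                          size F ≡ size T
  insRow-cancelled-size []           ()
  insRow-cancelled-size {k} {z} (R ∷ rows) h with splitBump z R in split
  insRow-cancelled-size (R ∷ rows) () | nothing
  insRow-cancelled-size {k} {z} (R ∷ rows) h | just (p , e , s)
    with isCancel k z e | splitBump-just z R split
  insRow-cancelled-size (R ∷ rows) refl | just (p , e , s) | true | refl , _ =
    cong₂ _+_ (length-map-++-∷ just p) (size-map-map just rows)
  ... | false | R≡ , _ with insRow (suc k) e rows in below
  insRow-cancelled-size (R ∷ rows) () | just (p , e , s) | false | _ | added _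
  insRow-cancelled-size (R ∷ rows) refl | just (p , e , s) | false | R≡ , _ | cancelled _ _ _ =
    cong₂ _+_ (trans (length-map just (p ++ _ ∷ s)) (trans (length-++-∷-swap p) (cong length (sym R≡))))
              (insRow-cancelled-size rows below)

  insert-grows : ∀ T x → size (insert T x) ≡ suc (size T) → insRow 0 x T ≡ added (insert T x)
  insert-grows T x grows with insRow 0 x T in ins
  ... | added _         = refl
  ... | cancelled F r c = contradiction too-big 1+n≰n
    where
    open ≤-Reasoning
    too-big : suc (size T) ≤ size T
    too-big = begin
      suc (size T)                 ≡⟨ sym grows ⟩
      size (slides (size T) F r c) ≤⟨ size-slides (size T) F r c ⟩
      size F                       ≡⟨ insRow-cancelled-size T ins ⟩
      size T                       ∎

  module _ {T : Tableau m n} (spo : IsSpoTableau T) where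
    open IsSpoTableau spo

    B0-closed : ∀ {r c r′ c′ x y} → entry T r c ≡ just x → entry T r′ c′ ≡ just y →
                r ≤ r′ → c ≤ c′ → isB0 y ≡ true → isB0 x ≡ true
    B0-closed hx hy r≤r′ c≤c′ by with shape0 _ _ _ _ r≤r′ c≤c′ (_ , hy , by)
    ... | _ , hx′ , bx′ with trans (sym hx) hx′
    ...   | refl = bx′

    spo-row-step : ∀ r c {x y} → entry T r c ≡ just x → entry T r (suc c) ≡ just y → x ≼ y
    spo-row-step r c {x} {y} hx hy with B0-or-B1 x | B0-or-B1 y
    ... | inj₁ bx | inj₁ by = ≤⇒≼ bx by (row0 r c x y hx hy bx by)
    ... | inj₁ bx | inj₂ by = <⇒≼ (B0<B1 bx by)
    ... | inj₂ bx | inj₁ by = contradiction (trans (sym bx) (B0-closed hx hy ≤-refl (n≤1+n c) by)) λ ()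
    ... | inj₂ bx | inj₂ by = <⇒≼ (row1 r c x y hx hy bx by)

    spo-column-step : ∀ r c {y} → entry T (suc r) c ≡ just y → ∃[ x ] entry T r c ≡ just x × x ⊲ y
    spo-column-step r c {y} hy with shape (suc r) c r c (n≤1+n r) ≤-refl (y , hy)
    ... | x , hx = x , hx , column (B0-or-B1 x) (B0-or-B1 y)
      where
      column : isB0 x ≡ true ⊎ isB0 x ≡ false → isB0 y ≡ true ⊎ isB0 y ≡ false → x ⊲ y
      column (inj₁ bx) (inj₁ by) y≼x = <⇒≱ (col0 r c x y hx hy bx by) (≼⇒≤ y≼x)
      column (inj₁ bx) (inj₂ by) y≼x = <⇒≱ (B0<B1 bx by) (≼⇒≤ y≼x)
      column (inj₂ bx) (inj₁ by) _   =
        contradiction (trans (sym bx) (B0-closed hx hy (n≤1+n r) ≤-refl by)) λ ()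
      column (inj₂ bx) (inj₂ by) y≼x = ≤⇒≯ (col1 r c x y hx hy bx by) (≼⇒<ˡ by y≼x)

  ordered : ∀ {T : Tableau m n} → IsSpoTableau T → Ordered _≼_ _⊲_ T
  ordered {T} spo = ordered-from-entries ≼-trans T (spo-row-step spo) (spo-column-step spo)

  All-≼-∷ʳ : ∀ {R z z′} → All (_≼ z) R → z ≼ z′ → All (_≼ z′) (R ∷ʳ z)
  All-≼-∷ʳ passed z≼z′ = ∷ʳ⁺ (All.map (λ a≼z → ≼-trans a≼z z≼z′) passed) z≼z′

  insRow-appends : ∀ {k z R rows T} → All (_≼ z) R → insRow k z (R ∷ rows) ≡ added T →
                   T ≡ (R ∷ʳ z) ∷ rows
  insRow-appends {R = R} {rows} passed ins with rowInsertion (R ∷ rows) ins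
  ... | appended _                   = refl
  ... | bumped {p = p} refl _ z⊲e _  = contradiction (All.head (++⁻ʳ p passed)) z⊲e

  newColumn-≤ : ∀ {k e p s rows T c} → Ordered _≼_ _⊲_ rows →
                Prefix (flip _⊲_) (topRow rows) (p ++ e ∷ s) →
                insRow k e rows ≡ added T → NewColumn rows T c → c ≤ length p
  newColumn-≤ {rows = rows} ord below ins new with rowInsertion rows ins
  ... | created = ≤-trans (≤-reflexive (NewColumn-singleton new)) z≤n
  newColumn-≤ {p = p} ord below ins new | appended {R} passed =
    ≤-trans (≤-reflexive (NewColumn-∷ʳ new))
      (Prefix-length-≤ R p (All.map ≼⇒¬⊲ passed)
        (subst (λ t → Prefix _ t _) (sym (++-identityʳ R)) below))
  newColumn-≤ {p = p} (row _ below₁ ord) below ins new | bumped {p = p₁} refl passed _ ins₁ =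
    ≤-trans (newColumn-≤ ord below₁ ins₁ (NewColumn-below (length-++-∷-swap p₁) new))
            (Prefix-length-≤ p₁ p (All.map ≼⇒¬⊲ passed) below)

  successive-newColumns-< : ∀ {k z z′ T T₁ T₂ c c′} → Ordered _≼_ _⊲_ T → z ≼ z′ →
                            insRow k z T ≡ added T₁ → insRow k z′ T₁ ≡ added T₂ →
                            NewColumn T T₁ c → NewColumn T₁ T₂ c′ → c < c′
  successive-newColumns-< {T = T} ord z≼z′ ins ins′ new new′ with rowInsertion T ins
  ... | created with insRow-appends (z≼z′ ∷ []) ins′
  ...   | refl rewrite NewColumn-singleton new | NewColumn-∷ʳ new′ = s≤s z≤n
  successive-newColumns-< ord z≼z′ ins ins′ new new′ | appended {R} passed
    with insRow-appends (All-≼-∷ʳ passed z≼z′) ins′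
  ... | refl rewrite NewColumn-∷ʳ new | NewColumn-∷ʳ new′ = length-<-++-∷ R
  successive-newColumns-< {z = z} (row chain below ord) z≼z′ ins ins′ new new′
    | bumped {p = p} {s = s} refl passed _ ins₁
    with rowInsertion ((p ++ z ∷ s) ∷ _) ins′
  ... | appended _ rewrite NewColumn-∷ʳ new′ =
    ≤-<-trans (newColumn-≤ ord below ins₁ (NewColumn-below (length-++-∷-swap p) new)) (length-<-++-∷ p)
  ... | bumped {p = p₂} row≡ _ z′⊲e′ ins₂
    with suffix-from-first-failure (p ∷ʳ z) p₂ (All-≼-∷ʳ passed z≼z′) z′⊲e′
           (trans (++-assoc p (z ∷ []) s) row≡)
  ...   | u , refl =
    successive-newColumns-< ord (AllPairs-before p u chain) ins₁ ins₂
      (NewColumn-below (length-++-∷-swap p) new)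
      (NewColumn-below (trans (cong length row≡) (length-++-∷-swap p₂)) new′)

lemma4p1 : (m n : ℕ) → 1 ≤ m → 1 ≤ n →
    (T : Tableau m n) → IsSpoTableau T →
    (x x' : Letter m n) → OrderHyp x x' →
    size (insert T x) ≡ suc (size T) →
    size (insert (insert T x) x') ≡ suc (size (insert T x)) →
    ∀ r c r' c' → NewBox T (insert T x) r c →
    NewBox (insert T x) (insert (insert T x) x') r' c' →
    c < c'
lemma4p1 m n _ _ T spo x x' x≼x' grows grows' r c r' c' new new' =
  successive-newColumns-< (ordered spo) (mk≼ x≼x')
    (insert-grows T x grows) (insert-grows (insert T x) x' grows')
    (newColumn r new) (newColumn r' new')
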